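{- Let $k\ge 2$ and let $n\ge 1$ be an integer. If we start with $N$ chips at the root of $T_k$, where $\frac{k^{n}-1}{k-1}\le N\le \frac{k^{n+1}-k}{k-1}$, then the vertices that contain chips in the stable configuration form a perfect $k$-ary tree of height $n-1$ rooted at the root (i.e. exactly the vertices on layers $1,\dots,n$), and every vertex on the same layer has the same number of chips.
   Context: Fix an integer $k\ge 2$. Let $T_k$ be the infinite rooted $k$-ary tree (every vertex has exactly $k$ children) with one additional self-loop at the root, so every vertex has degree $k+1$. A vertex is on layer $i+1$ if its distance from the root is $i$ (the root is on layer 1). A perfect $k$-ary tree of height $h$ is a rooted tree in which every non-leaf vertex has $k$ children and all leaves are at distance $h$ from the root. Chip-firing: a configuration assigns a nonnegative integer number of chips to each vertex; a vertex with at least $k+1$ chips may fire, sending one chip along each incident edge (a non-root vertex sends one chip to its parent and one to each of its $k$ children; the root sends one chip to each of its $k$ children and one chip to itself along the self-loop). Starting with $N$ chips at the root and none elsewhere, vertices fire until no vertex can fire; this always terminates, and the resulting stable configuration (every vertex has at most $k$ chips) is independent of the order of firings. -}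

module Defs where

open import Data.Nat using (ℕ; zero; suc; _+_; _∸_; _≤_)
open import Data.Bool using (Bool; true; false; if_then_else_)
open import Data.Fin as Fin using (Fin)
open import Data.List using (List; []; _∷_)
import Data.List.Properties as LP
open import Relation.Nullary using (Dec; yes; no)
open import Relation.Nullary.Decidable using (⌊_⌋)
open import Relation.Binary.PropositionalEquality using (_≡_)
open import Relation.Binary.Construct.Closure.ReflexiveTransitive using (Star)

-- Vertices of T_k: a vertex is the path from the root, listed from the
-- vertex upwards: [] is the root, and the i-th child of v is (i ∷ v).
-- Its layer is (length v + 1).
Vertex : ℕ → Set
Vertex k = List (Fin k)

_≟V_ : ∀ {k} → (v w : Vertex k) → Dec (v ≡ w)
_≟V_ = LP.≡-dec Fin._≟_

Config : ℕ → Set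
Config k = Vertex k → ℕ

b2n : Bool → ℕ
b2n true = 1
b2n false = 0

isChildOf : ∀ {k} → Vertex k → Vertex k → Bool
isChildOf [] p = false
isChildOf (i ∷ c) p = ⌊ c ≟V p ⌋

isRoot : ∀ {k} → Vertex k → Bool
isRoot [] = true
isRoot (_ ∷ _) = false

-- number of edges of T_k joining v and w (self-loop at the root counted once)
edges : ∀ {k} → Vertex k → Vertex k → ℕ
edges v w = b2n (isRoot v Data.Bool.∧ isRoot w) + b2n (isChildOf w v) + b2n (isChildOf v w)

-- fire vertex v: it loses k+1 chips and each edge at v carries one chip
-- to the other endpoint (the self-loop returns one chip to the root).
fire : ∀ {k} → Config k → Vertex k → Config k
fire {k} c v w = (if ⌊ w ≟V v ⌋ then c w ∸ suc k else c w) + edges v w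

data _⟶_ {k : ℕ} (c : Config k) : Config k → Set where
  step : (v : Vertex k) → suc k ≤ c v → c ⟶ fire c v

_⟶*_ : ∀ {k} → Config k → Config k → Set
_⟶*_ = Star _⟶_

Stable : ∀ {k} → Config k → Set
Stable {k} c = ∀ v → c v ≤ k

initial : ∀ {k} → ℕ → Config k
initial N [] = N
initial N (_ ∷ _) = 0

{-# OPTIONS --safe #-}
-- Write N in bijective base k, N = ∑_{d<n} a_d k^d with digits a_d ∈ {1, …, k}; the bounds on N say
-- exactly that it has n such digits.  Let shifted d = ∑_{j≥d} a_j k^(j-d) be N with its d lowest
-- digits removed, so shifted d = a_d + k · shifted (d + 1), and let firings d = ∑_{e>d} shifted e.
-- If every vertex at depth d fires firings d times, it ends with a_d ≤ k chips: it receives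
-- firings (d - 1) from its parent (for the root: N, plus firings 0 through the self-loop) and
-- k · firings (d + 1) from its children.  So this odometer is stabilizing: by the least action
-- principle no legal firing sequence exceeds it, and firing greedily below it terminates in a
-- stable configuration.  Conversely, let a stable configuration be reached with odometer u.  A vertex
-- at depth d < n whose net inflow from its parent is at least shifted d keeps at most k < a_d + k
-- chips, so by pigeonhole one of its k children has net inflow at least shifted (d + 1); following
-- such children down to depth n gives u ≥ firings d at the starting vertex.  As u ≤ firings, induction
-- from the root shows u = firings everywhere, so every vertex at depth d holds a_d chips.
module Submission where

open import Defs
open import Data.Nat using (ℕ; _+_; _*_; _∸_; _^_; _≤_; _<_; suc)
open import Data.List using (length)
open import Data.Product using (_×_; ∃-syntax)
open import Function.Bundles using (_⇔_)
open import Relation.Binary.PropositionalEquality using (_≡_)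

open import Data.Nat using (zero; z≤n; s≤s; _≤?_; _<?_; NonZero)
open import Data.Nat.Properties
open import Data.Nat.DivMod using (_/_; _%_; m≡m%n+[m/n]*n; m%n<n; 0/n≡0; m*n/n≡m; /-monoˡ-≤; m<n*o⇒m/o<n)
open import Data.Nat.Tactic.RingSolver using (solve-∀)
open import Algebra.Properties.CommutativeMonoid.Sum +-0-commutativeMonoid using (sum; ∑-distrib-+; sum-replicate-zero; sum-cong-≗)
open import Algebra.Properties.CommutativeSemigroup +-commutativeSemigroup using (interchange; x∙yz≈y∙xz; x∙yz≈xz∙y; xy∙z≈xz∙y; xy∙z≈y∙xz)
open import Data.Fin using (Fin; zero; suc)
import Data.Fin.Properties as Fin
open import Data.Bool using (_∧_)
open import Data.List using (List; []; _∷_; [_]; _++_; map; allFin; cartesianProductWith)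
import Data.Nat.ListAction as ListAction
open import Data.List.Properties using (∷-injectiveˡ; ∷-injectiveʳ)
open import Data.List.Membership.Propositional using (_∈_; find; lose)
open import Data.List.Membership.Propositional.Properties using (∈-allFin; ∈-cartesianProductWith⁺; ∈-++⁺ˡ; ∈-++⁺ʳ)
open import Data.List.Relation.Unary.Any using (here; there; any?)
open import Data.Product using (_,_; proj₁; proj₂)
open import Data.Sum using (inj₁; inj₂)
open import Function.Base using (_∘_)
open import Function.Bundles using (mk⇔)
open import Relation.Nullary using (yes; no; contradiction)
open import Relation.Nullary.Decidable using (⌊_⌋)
open import Relation.Binary.PropositionalEquality using (refl; sym; trans; cong; cong₂; subst; _≢_; module ≡-Reasoning)
open import Relation.Binary.Construct.Closure.ReflexiveTransitive using (ε; _◅_)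

sum-const : ∀ m x → sum {m} (λ _ → x) ≡ m * x
sum-const zero x = refl
sum-const (suc m) x = cong (x +_) (sum-const m x)

sum-zero : ∀ {m} {f : Fin m → ℕ} → (∀ i → f i ≡ 0) → sum f ≡ 0
sum-zero {m} f≡0 = trans (sum-cong-≗ f≡0) (sum-replicate-zero m)

sum-mono-≤ : ∀ {m} {f g : Fin m → ℕ} → (∀ i → f i ≤ g i) → sum f ≤ sum g
sum-mono-≤ {zero} f≤g = z≤n
sum-mono-≤ {suc m} f≤g = +-mono-≤ (f≤g zero) (sum-mono-≤ (f≤g ∘ suc))

sum-δ : ∀ {m} (f : Fin m → ℕ) j → f j ≡ 1 → (∀ i → i ≢ j → f i ≡ 0) → sum f ≡ 1
sum-δ f zero fj≡1 f≡0 = cong₂ _+_ fj≡1 (sum-zero (λ i → f≡0 (suc i) λ ()))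
sum-δ f (suc j) fj≡1 f≡0 =
  cong₂ _+_ (f≡0 zero λ ()) (sum-δ (f ∘ suc) j fj≡1 (λ i i≢j → f≡0 (suc i) (i≢j ∘ Fin.suc-injective)))

pigeonhole-≤ : ∀ {m} t (g : Fin m → ℕ) → sum g < m * suc t → ∃[ i ] g i ≤ t
pigeonhole-≤ {zero} t g ()
pigeonhole-≤ {suc m} t g Σg<m*[1+t] with g zero ≤? t
... | yes g₀≤t = zero , g₀≤t
... | no g₀≰t =
  let i , gi≤t = pigeonhole-≤ t (g ∘ suc)
                   (+-cancelˡ-< (suc t) _ _ (≤-<-trans (+-monoˡ-≤ _ (≰⇒> g₀≰t)) Σg<m*[1+t]))
  in suc i , gi≤t

sum-map-mono-≤ : ∀ {a} {A : Set a} {f g : A → ℕ} → (∀ x → f x ≤ g x) →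
                 ∀ xs → ListAction.sum (map f xs) ≤ ListAction.sum (map g xs)
sum-map-mono-≤ f≤g [] = z≤n
sum-map-mono-≤ f≤g (x ∷ xs) = +-mono-≤ (f≤g x) (sum-map-mono-≤ f≤g xs)

sum-map-mono-< : ∀ {a} {A : Set a} {f g : A → ℕ} {x xs} →
                 (∀ y → f y ≤ g y) → x ∈ xs → f x < g x →
                 ListAction.sum (map f xs) < ListAction.sum (map g xs)
sum-map-mono-< {xs = _ ∷ xs} f≤g (here refl) fx<gx = +-mono-<-≤ fx<gx (sum-map-mono-≤ f≤g xs)
sum-map-mono-< f≤g (there x∈xs) fx<gx = +-mono-≤-< (f≤g _) (sum-map-mono-< f≤g x∈xs fx<gx)

module ChipFiring (k : ℕ) where

  _≤̇_ : (Vertex k → ℕ) → (Vertex k → ℕ) → Set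
  u ≤̇ x = ∀ w → u w ≤ x w

  -- Through the self-loop the root is its own parent.
  parent : Vertex k → Vertex k
  parent [] = []
  parent (_ ∷ w) = w

  inflow : (Vertex k → ℕ) → Vertex k → ℕ
  inflow u w = u (parent w) + sum (λ i → u (i ∷ w))

  δ : Vertex k → Vertex k → ℕ
  δ v w = b2n ⌊ w ≟V v ⌋

  δ-self : ∀ v → δ v v ≡ 1
  δ-self v with v ≟V v
  ... | yes _ = refl
  ... | no v≢v = contradiction refl v≢v

  δ-other : ∀ {v w} → w ≢ v → δ v w ≡ 0
  δ-other {v} {w} w≢v with w ≟V v
  ... | yes w≡v = contradiction w≡v w≢v
  ... | no _ = refl

  inflow-mono : ∀ {u x} → u ≤̇ x → inflow u ≤̇ inflow x
  inflow-mono u≤x w = +-mono-≤ (u≤x (parent w)) (sum-mono-≤ (λ i → u≤x (i ∷ w)))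

  inflow-cong : ∀ {u x} → (∀ w → u w ≡ x w) → ∀ w → inflow u w ≡ inflow x w
  inflow-cong u≡x w = cong₂ _+_ (u≡x (parent w)) (sum-cong-≗ (λ i → u≡x (i ∷ w)))

  inflow-+ : ∀ u x w → inflow (λ v → u v + x v) w ≡ inflow u w + inflow x w
  inflow-+ u x w = begin
      u (parent w) + x (parent w) + sum (λ i → u (i ∷ w) + x (i ∷ w))
    ≡⟨ cong (u (parent w) + x (parent w) +_) (∑-distrib-+ (λ i → u (i ∷ w)) (λ i → x (i ∷ w))) ⟩
      u (parent w) + x (parent w) + (sum (λ i → u (i ∷ w)) + sum (λ i → x (i ∷ w)))
    ≡⟨ interchange (u (parent w)) (x (parent w)) (sum (λ i → u (i ∷ w))) (sum (λ i → x (i ∷ w))) ⟩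
      inflow u w + inflow x w
    ∎
    where open ≡-Reasoning

  inflow-δ : ∀ v w → inflow (δ v) w ≡ edges v w
  inflow-δ v w = cong₂ _+_ (from-parent v w) (from-children v w)
    where
    from-parent : ∀ v w → δ v (parent w) ≡ b2n (isRoot v ∧ isRoot w) + b2n (isChildOf w v)
    from-parent [] [] = refl
    from-parent (_ ∷ _) [] = refl
    from-parent [] (_ ∷ _) = refl
    from-parent (_ ∷ _) (_ ∷ _) = refl
    from-children : ∀ v w → sum (λ i → δ v (i ∷ w)) ≡ b2n (isChildOf v w)
    from-children [] w = sum-zero {k} λ _ → refl
    from-children (j ∷ v) w with v ≟V w
    ... | yes refl = sum-δ _ j (δ-self (j ∷ v)) (λ i i≢j → δ-other (i≢j ∘ ∷-injectiveˡ))
    ... | no v≢w = sum-zero (λ i → δ-other {j ∷ v} {i ∷ w} (v≢w ∘ sym ∘ ∷-injectiveʳ))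

  fire-balance : ∀ {c v} → suc k ≤ c v → ∀ w → fire c v w + suc k * δ v w ≡ c w + edges v w
  fire-balance {c} {v} k<cv w with w ≟V v
  ... | yes refl = begin
      c w ∸ suc k + edges v w + suc k * 1  ≡⟨ cong (c w ∸ suc k + edges v w +_) (*-identityʳ (suc k)) ⟩
      c w ∸ suc k + edges v w + suc k      ≡⟨ xy∙z≈xz∙y (c w ∸ suc k) (edges v w) (suc k) ⟩
      c w ∸ suc k + suc k + edges v w      ≡⟨ cong (_+ edges v w) (m∸n+n≡m k<cv) ⟩
      c w + edges v w                      ∎
    where open ≡-Reasoning
  ... | no _ = trans (cong (c w + edges v w +_) (*-zeroʳ (suc k))) (+-identityʳ _)

  record Odometer (c₀ c : Config k) (u : Vertex k → ℕ) : Set where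
    constructor mkOdometer
    field balance : ∀ w → c w + suc k * u w ≡ c₀ w + inflow u w
  open Odometer public

  odometer-refl : ∀ {c₀} → Odometer c₀ c₀ (λ _ → 0)
  odometer-refl {c₀} = mkOdometer λ w → cong (c₀ w +_) (trans (*-zeroʳ (suc k)) (sym (sum-zero {k} λ _ → refl)))

  odometer-fire : ∀ {c₀ c u} v → Odometer c₀ c u → suc k ≤ c v →
                  Odometer c₀ (fire c v) (λ w → u w + δ v w)
  odometer-fire {c₀} {c} {u} v odo k<cv = mkOdometer λ w → begin
      fire c v w + suc k * (u w + δ v w)         ≡⟨ distribute (fire c v w) (suc k) (u w) (δ v w) ⟩
      (fire c v w + suc k * δ v w) + suc k * u w ≡⟨ cong (_+ suc k * u w) (fire-balance k<cv w) ⟩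
      c w + edges v w + suc k * u w              ≡⟨ xy∙z≈xz∙y (c w) (edges v w) (suc k * u w) ⟩
      (c w + suc k * u w) + edges v w            ≡⟨ cong₂ _+_ (balance odo w) (sym (inflow-δ v w)) ⟩
      (c₀ w + inflow u w) + inflow (δ v) w       ≡⟨ +-assoc (c₀ w) _ _ ⟩
      c₀ w + (inflow u w + inflow (δ v) w)       ≡⟨ cong (c₀ w +_) (sym (inflow-+ u (δ v) w)) ⟩
      c₀ w + inflow (λ w → u w + δ v w) w        ∎
    where
    open ≡-Reasoning
    distribute : ∀ a b c d → a + b * (c + d) ≡ (a + b * d) + b * c
    distribute = solve-∀

  Stabilizing : Config k → (Vertex k → ℕ) → Set
  Stabilizing c₀ x = ∀ w → c₀ w + inflow x w ≤ k + suc k * x w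

  module LeastAction {c₀ x} (x-stabilizing : Stabilizing c₀ x) where

    unstable⇒below : ∀ {c u} v → Odometer c₀ c u → u ≤̇ x → suc k ≤ c v → u v < x v
    unstable⇒below {c} {u} v odo u≤x k<cv with u v <? x v
    ... | yes uv<xv = uv<xv
    ... | no uv≮xv = contradiction (+-cancelʳ-≤ (suc k * u v) (c v) k stays-stable) (<⇒≱ k<cv)
      where
      stays-stable : c v + suc k * u v ≤ k + suc k * u v
      stays-stable = begin
        c v + suc k * u v  ≡⟨ balance odo v ⟩
        c₀ v + inflow u v  ≤⟨ +-monoʳ-≤ (c₀ v) (inflow-mono u≤x v) ⟩
        c₀ v + inflow x v  ≤⟨ x-stabilizing v ⟩
        k + suc k * x v    ≤⟨ +-monoʳ-≤ k (*-monoʳ-≤ (suc k) (≮⇒≥ uv≮xv)) ⟩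
        k + suc k * u v    ∎
        where open ≤-Reasoning

    fire-below : ∀ {c u} v → Odometer c₀ c u → u ≤̇ x → suc k ≤ c v → (λ w → u w + δ v w) ≤̇ x
    fire-below {c} {u} v odo u≤x k<cv w with w ≟V v
    ... | yes refl = subst (_≤ x w) (+-comm 1 (u w)) (unstable⇒below v odo u≤x k<cv)
    ... | no _ = subst (_≤ x w) (sym (+-identityʳ (u w))) (u≤x w)

    least-action : ∀ {c d u} → Odometer c₀ c u → u ≤̇ x → c ⟶* d →
                   ∃[ u′ ] (Odometer c₀ d u′ × u′ ≤̇ x)
    least-action {u = u} odo u≤x ε = u , odo , u≤x
    least-action odo u≤x (step v k<cv ◅ ρ) =
      least-action (odometer-fire v odo k<cv) (fire-below v odo u≤x k<cv) ρ

  module Greedy {c₀ x} (x-stabilizing : Stabilizing c₀ x)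
                (support : List (Vertex k)) (x-support : ∀ w → 0 < x w → w ∈ support) where
    open LeastAction {c₀} {x} x-stabilizing

    deficit : (Vertex k → ℕ) → ℕ
    deficit u = ListAction.sum (map (λ w → x w ∸ u w) support)

    deficit-fire : ∀ {c u} v → Odometer c₀ c u → u ≤̇ x → suc k ≤ c v →
                   deficit (λ w → u w + δ v w) < deficit u
    deficit-fire {c} {u} v odo u≤x k<cv =
      sum-map-mono-< (λ w → ∸-monoʳ-≤ (x w) (m≤m+n (u w) (δ v w)))
        (x-support v (≤-<-trans z≤n uv<xv)) drops
      where
      uv<xv : u v < x v
      uv<xv = unstable⇒below v odo u≤x k<cv
      drops : x v ∸ (u v + δ v v) < x v ∸ u v
      drops rewrite δ-self v | +-comm (u v) 1 = ∸-monoʳ-< (n<1+n (u v)) uv<xv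

    stabilize-within : ∀ fuel {c u} → Odometer c₀ c u → u ≤̇ x → deficit u < fuel →
                       ∃[ d ] (c ⟶* d × Stable d)
    stabilize-within zero odo u≤x ()
    stabilize-within (suc fuel) {c} odo u≤x deficit<1+fuel with any? (λ v → suc k ≤? c v) support
    ... | yes some-unstable =
      let v , _ , k<cv = find some-unstable
          d , c⟶*d , d-stable = stabilize-within fuel (odometer-fire v odo k<cv) (fire-below v odo u≤x k<cv)
                                  (<-≤-trans (deficit-fire v odo u≤x k<cv) (≤-pred deficit<1+fuel))
      in d , step v k<cv ◅ c⟶*d , d-stable
    ... | no none-unstable = c , ε , c-stable
      where
      c-stable : Stable c
      c-stable w with suc k ≤? c w
      ... | yes k<cw =
        contradiction (lose (x-support w (≤-<-trans z≤n (unstable⇒below w odo u≤x k<cw))) k<cw) none-unstable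
      ... | no k≮cw = ≮⇒≥ k≮cw

    stabilize : ∃[ c ] (c₀ ⟶* c × Stable c)
    stabilize = stabilize-within (suc (deficit (λ _ → 0))) odometer-refl (λ _ → z≤n) (n<1+n _)

  layer : ℕ → List (Vertex k)
  layer zero = [ [] ]
  layer (suc d) = cartesianProductWith _∷_ (allFin k) (layer d)

  ∈-layer : ∀ v → v ∈ layer (length v)
  ∈-layer [] = here refl
  ∈-layer (i ∷ v) = ∈-cartesianProductWith⁺ _∷_ (∈-allFin i) (∈-layer v)

  ball : ℕ → List (Vertex k)
  ball zero = []
  ball (suc n) = layer n ++ ball n

  ∈-ball : ∀ {n v} → length v < n → v ∈ ball n
  ∈-ball {suc n} {v} |v|<1+n with m<1+n⇒m<n∨m≡n |v|<1+n
  ... | inj₁ |v|<n = ∈-++⁺ʳ (layer n) (∈-ball |v|<n)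
  ... | inj₂ refl = ∈-++⁺ˡ (∈-layer v)

repunit : ℕ → ℕ → ℕ
repunit k zero = 0
repunit k (suc m) = 1 + k * repunit k m

-- T has exactly m digits in bijective base k, i.e. T = ∑_{d<m} a_d k^d with all a_d ∈ {1, …, k}.
HasDigits : ℕ → ℕ → ℕ → Set
HasDigits k m T = repunit k m ≤ T × T ≤ k * repunit k m

^-repunit : ∀ k₀ m → suc k₀ ^ m ≡ 1 + repunit (suc k₀) m * k₀
^-repunit k₀ zero = refl
^-repunit k₀ (suc m) = begin
    suc k₀ * suc k₀ ^ m                            ≡⟨ cong (suc k₀ *_) (^-repunit k₀ m) ⟩
    suc k₀ * (1 + repunit (suc k₀) m * k₀)         ≡⟨ expand k₀ (repunit (suc k₀) m) ⟩
    1 + (1 + suc k₀ * repunit (suc k₀) m) * k₀     ∎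
  where
  open ≡-Reasoning
  expand : ∀ k₀ r → suc k₀ * (1 + r * k₀) ≡ 1 + (1 + suc k₀ * r) * k₀
  expand = solve-∀

HasDigits-from-powers : ∀ k₀ .{{_ : NonZero k₀}} n N →
  suc k₀ ^ n ∸ 1 ≤ N * k₀ → N * k₀ ≤ suc k₀ ^ suc n ∸ suc k₀ → HasDigits (suc k₀) n N
HasDigits-from-powers k₀ n N lower upper =
    *-cancelʳ-≤ (repunit k n) N k₀ (subst (λ p → p ∸ 1 ≤ N * k₀) (^-repunit k₀ n) lower)
  , *-cancelʳ-≤ N (k * repunit k n) k₀
      (subst (N * k₀ ≤_) (m+n∸m≡n k (k * repunit k n * k₀))
        (subst (λ p → N * k₀ ≤ p ∸ k) (^-repunit k₀ (suc n)) upper))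
  where k = suc k₀

module BijectiveDigits (k : ℕ) .{{_ : NonZero k}} where

  next : ℕ → ℕ
  next T = (T ∸ 1) / k

  digit : ℕ → ℕ
  digit zero = 0
  digit (suc T) = suc (T % k)

  digit+k*next : ∀ T → T ≡ digit T + k * next T
  digit+k*next zero = sym (trans (cong (k *_) (0/n≡0 k)) (*-zeroʳ k))
  digit+k*next (suc T) = cong suc (trans (m≡m%n+[m/n]*n T k) (cong (T % k +_) (*-comm (T / k) k)))

  digit≤k : ∀ T → digit T ≤ k
  digit≤k zero = z≤n
  digit≤k (suc T) = m%n<n T k

  0<digit : ∀ {T} → 0 < T → 0 < digit T
  0<digit {suc T} _ = s≤s z≤n

  next-HasDigits : ∀ {m T} → HasDigits k (suc m) T → HasDigits k m (next T)
  next-HasDigits {m} {suc T} (lower , upper) =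
      subst (_≤ T / k) (trans (cong (_/ k) (*-comm k (repunit k m))) (m*n/n≡m (repunit k m) k))
        (/-monoˡ-≤ k (≤-pred lower))
    , ≤-pred (m<n*o⇒m/o<n (subst (T <_) (*-comm k (repunit k (suc m))) upper))

  module Expansion (n N : ℕ) (N-digits : HasDigits k n N) where

    shifted : ℕ → ℕ
    shifted zero = N
    shifted (suc d) = next (shifted d)

    digitAt : ℕ → ℕ
    digitAt d = digit (shifted d)

    shifted-digits : ∀ d → shifted d ≡ digitAt d + k * shifted (suc d)
    shifted-digits d = digit+k*next (shifted d)

    shifted-HasDigits : ∀ {d m} → d + m ≡ n → HasDigits k m (shifted d)
    shifted-HasDigits {zero} refl = N-digits
    shifted-HasDigits {suc d} {m} d+m≡n =
      next-HasDigits {m} {shifted d} (shifted-HasDigits {d} {suc m} (trans (+-suc d m) d+m≡n))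

    shifted-pos : ∀ {d} → d < n → 0 < shifted d
    shifted-pos {d} d<n =
      let o , 1+d+o≡n = m≤n⇒∃[o]m+o≡n d<n
      in ≤-trans (s≤s z≤n) (proj₁ (shifted-HasDigits {d} {suc o} (trans (+-suc d o) 1+d+o≡n)))

    shifted-vanishes : ∀ {d} → n ≤ d → shifted d ≡ 0
    shifted-vanishes n≤d with m≤n⇒∃[o]m+o≡n n≤d
    ... | o , refl = beyond o
      where
      beyond : ∀ o → shifted (n + o) ≡ 0
      beyond zero = n≤0⇒n≡0 (subst (shifted (n + 0) ≤_) (*-zeroʳ k)
                      (proj₂ (shifted-HasDigits {n + 0} {0} (trans (+-identityʳ (n + 0)) (+-identityʳ n)))))
      beyond (suc o) = begin
        shifted (n + suc o)       ≡⟨ cong shifted (+-suc n o) ⟩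
        next (shifted (n + o))    ≡⟨ cong next (beyond o) ⟩
        0 / k                     ≡⟨ 0/n≡0 k ⟩
        0                         ∎
        where open ≡-Reasoning

    0<digitAt⇔ : ∀ d → 0 < digitAt d ⇔ d < n
    0<digitAt⇔ d = mk⇔ to (0<digit ∘ shifted-pos)
      where
      to : 0 < digitAt d → d < n
      to 0<a with d <? n
      ... | yes d<n = d<n
      ... | no d≮n = contradiction (subst (0 <_) (cong digit (shifted-vanishes (≮⇒≥ d≮n))) 0<a) (λ ())

    -- Every vertex at depth d fires firings d = shifted (d + 1) + … + shifted n times.
    firingsFor : ℕ → ℕ → ℕ
    firingsFor zero d = 0
    firingsFor (suc m) d = shifted (suc d) + firingsFor m (suc d)

    firings : ℕ → ℕ
    firings d = firingsFor (n ∸ d) d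

    firings-vanishes : ∀ {d} → n ≤ d → firings d ≡ 0
    firings-vanishes {d} n≤d = cong (λ m → firingsFor m d) (m≤n⇒m∸n≡0 n≤d)

    firings-step : ∀ d → firings d ≡ shifted (suc d) + firings (suc d)
    firings-step d with d <? n
    ... | yes d<n = cong (λ m → firingsFor m d) (+-∸-assoc 1 d<n)
    ... | no d≮n = begin
      firings d                          ≡⟨ firings-vanishes n≤d ⟩
      0                                  ≡⟨ cong₂ _+_ (sym (shifted-vanishes n≤1+d)) (sym (firings-vanishes n≤1+d)) ⟩
      shifted (suc d) + firings (suc d)  ∎
      where
      open ≡-Reasoning
      n≤d = ≮⇒≥ d≮n
      n≤1+d = m≤n⇒m≤1+n n≤d

    firings-balance : ∀ d → shifted d + k * firings (suc d) ≡ digitAt d + k * firings d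
    firings-balance d = begin
        shifted d + k * firings (suc d)
      ≡⟨ cong (_+ k * firings (suc d)) (shifted-digits d) ⟩
        digitAt d + k * shifted (suc d) + k * firings (suc d)
      ≡⟨ +-assoc (digitAt d) _ _ ⟩
        digitAt d + (k * shifted (suc d) + k * firings (suc d))
      ≡⟨ cong (digitAt d +_) (sym (*-distribˡ-+ k _ _)) ⟩
        digitAt d + k * (shifted (suc d) + firings (suc d))
      ≡⟨ cong (λ f → digitAt d + k * f) (sym (firings-step d)) ⟩
        digitAt d + k * firings d
      ∎
      where open ≡-Reasoning

module Stabilization (k : ℕ) .{{_ : NonZero k}} (n N : ℕ) (N-digits : HasDigits k n N) where
  open ChipFiring k
  open BijectiveDigits k
  open Expansion n N N-digits

  odometer : Vertex k → ℕ
  odometer w = firings (length w)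

  inflow-odometer : ∀ w → let d = length w in
                    initial N w + inflow odometer w ≡ odometer w + (shifted d + k * firings (suc d))
  inflow-odometer [] = begin
      N + (firings 0 + sum {k} (λ _ → firings 1))
    ≡⟨ cong (λ s → N + (firings 0 + s)) (sum-const k (firings 1)) ⟩
      N + (firings 0 + k * firings 1)
    ≡⟨ x∙yz≈y∙xz N (firings 0) (k * firings 1) ⟩
      firings 0 + (N + k * firings 1)
    ∎
    where open ≡-Reasoning
  inflow-odometer (_ ∷ p) = begin
      firings d + sum {k} (λ _ → firings (2 + d))
    ≡⟨ cong₂ _+_ (firings-step d) (sum-const k (firings (2 + d))) ⟩
      shifted (1 + d) + firings (1 + d) + k * firings (2 + d)
    ≡⟨ xy∙z≈y∙xz (shifted (1 + d)) (firings (1 + d)) (k * firings (2 + d)) ⟩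
      firings (1 + d) + (shifted (1 + d) + k * firings (2 + d))
    ∎
    where
    open ≡-Reasoning
    d = length p

  initial-balance : ∀ w → initial N w + inflow odometer w ≡ digitAt (length w) + suc k * odometer w
  initial-balance w = begin
      initial N w + inflow odometer w                ≡⟨ inflow-odometer w ⟩
      odometer w + (shifted d + k * firings (suc d))  ≡⟨ cong (odometer w +_) (firings-balance d) ⟩
      odometer w + (digitAt d + k * odometer w)       ≡⟨ x∙yz≈y∙xz (odometer w) (digitAt d) (k * odometer w) ⟩
      digitAt d + suc k * odometer w                  ∎
    where
    open ≡-Reasoning
    d = length w

  odometer-stabilizing : Stabilizing (initial N) odometer
  odometer-stabilizing w = subst (_≤ k + suc k * odometer w) (sym (initial-balance w))
    (+-monoˡ-≤ (suc k * odometer w) (digit≤k (shifted (length w))))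

  odometer-support : ∀ w → 0 < odometer w → w ∈ ball n
  odometer-support w 0<odometer with length w <? n
  ... | yes |w|<n = ∈-ball |w|<n
  ... | no |w|≮n = contradiction (subst (0 <_) (firings-vanishes (≮⇒≥ |w|≮n)) 0<odometer) (λ ())

  initial-stabilizes : ∃[ c ] (initial N ⟶* c × Stable c)
  initial-stabilizes = Greedy.stabilize odometer-stabilizing (ball n) odometer-support

  module Forced {c u} (odo : Odometer (initial N) c u) (c-stable : Stable c) (u≤odometer : u ≤̇ odometer) where

    -- c v + k u v − ∑ᵢ u (i ∷ v) = u (parent v) − u v is the net number of chips v receives from its
    -- parent (from the initial pile, for the root); Fed v says that this is at least shifted |v|.
    Fed : Vertex k → Set
    Fed v = shifted (length v) + sum (λ i → u (i ∷ v)) ≤ c v + k * u v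

    root-fed : Fed []
    root-fed = ≤-reflexive (+-cancelˡ-≡ (u []) _ _ (begin
        u [] + (N + Σu)           ≡⟨ x∙yz≈y∙xz (u []) N Σu ⟩
        N + (u [] + Σu)           ≡⟨ sym (balance odo []) ⟩
        c [] + suc k * u []       ≡⟨ x∙yz≈y∙xz (c []) (u []) (k * u []) ⟩
        u [] + (c [] + k * u [])  ∎))
      where
      open ≡-Reasoning
      Σu = sum (λ i → u (i ∷ []))

    child-fed : ∀ {i v} → shifted (suc (length v)) + u (i ∷ v) ≤ u v → Fed (i ∷ v)
    child-fed {i} {v} received = +-cancelʳ-≤ (u (i ∷ v)) _ _ (begin
        S + Σu + u (i ∷ v)                      ≡⟨ xy∙z≈xz∙y S Σu (u (i ∷ v)) ⟩
        S + u (i ∷ v) + Σu                      ≤⟨ +-monoˡ-≤ Σu received ⟩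
        u v + Σu                                ≡⟨ sym (balance odo (i ∷ v)) ⟩
        c (i ∷ v) + suc k * u (i ∷ v)           ≡⟨ x∙yz≈xz∙y (c (i ∷ v)) (u (i ∷ v)) (k * u (i ∷ v)) ⟩
        c (i ∷ v) + k * u (i ∷ v) + u (i ∷ v)   ∎)
      where
      open ≤-Reasoning
      S = shifted (suc (length v))
      Σu = sum (λ l → u (l ∷ i ∷ v))

    fed⇒feeds-some-child : ∀ {v} → Fed v → length v < n →
                           ∃[ i ] shifted (suc (length v)) + u (i ∷ v) ≤ u v
    fed⇒feeds-some-child {v} fed |v|<n = pigeonhole-≤ (u v) (λ i → S′ + u (i ∷ v)) (begin-strict
        sum (λ i → S′ + u (i ∷ v))  ≡⟨ ∑-distrib-+ (λ _ → S′) (λ i → u (i ∷ v)) ⟩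
        sum {k} (λ _ → S′) + Σu     ≡⟨ cong (_+ Σu) (sum-const k S′) ⟩
        k * S′ + Σu                 <⟨ +-monoˡ-< Σu (m<n+m (k * S′) (0<digit (shifted-pos |v|<n))) ⟩
        digitAt d + k * S′ + Σu     ≡⟨ cong (_+ Σu) (sym (shifted-digits d)) ⟩
        shifted d + Σu              ≤⟨ fed ⟩
        c v + k * u v               ≤⟨ +-monoˡ-≤ (k * u v) (c-stable v) ⟩
        k + k * u v                 ≡⟨ sym (*-suc k (u v)) ⟩
        k * suc (u v)               ∎)
      where
      open ≤-Reasoning
      d = length v
      S′ = shifted (suc d)
      Σu = sum (λ i → u (i ∷ v))

    fed⇒firings≤ : ∀ m v → n ≤ m + length v → Fed v → firings (length v) ≤ u v
    fed⇒firings≤ m v n≤m+|v| fed with n ≤? length v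
    ... | yes n≤|v| = subst (_≤ u v) (sym (firings-vanishes n≤|v|)) z≤n
    fed⇒firings≤ zero v n≤|v| fed | no n≰|v| = contradiction n≤|v| n≰|v|
    fed⇒firings≤ (suc m) v n≤m+|v| fed | no n≰|v| =
      let i , received = fed⇒feeds-some-child fed (≰⇒> n≰|v|)
      in begin
        firings d                          ≡⟨ firings-step d ⟩
        shifted (suc d) + firings (suc d)  ≤⟨ +-monoʳ-≤ _ (fed⇒firings≤ m (i ∷ v) n≤m+|i∷v| (child-fed received)) ⟩
        shifted (suc d) + u (i ∷ v)        ≤⟨ received ⟩
        u v                                ∎
      where
      open ≤-Reasoning
      d = length v
      n≤m+|i∷v| = subst (n ≤_) (sym (+-suc m d)) n≤m+|v|

    odometer-forced : ∀ w → u w ≡ odometer w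
    odometer-forced [] =
      ≤-antisym (u≤odometer []) (fed⇒firings≤ n [] (≤-reflexive (sym (+-identityʳ n))) root-fed)
    odometer-forced (i ∷ p) =
      ≤-antisym (u≤odometer (i ∷ p)) (fed⇒firings≤ n (i ∷ p) (m≤m+n n _) (child-fed received))
      where
      open ≤-Reasoning
      d = length p
      received : shifted (suc d) + u (i ∷ p) ≤ u p
      received = begin
        shifted (suc d) + u (i ∷ p)        ≤⟨ +-monoʳ-≤ _ (u≤odometer (i ∷ p)) ⟩
        shifted (suc d) + firings (suc d)  ≡⟨ sym (firings-step d) ⟩
        firings d                          ≡⟨ sym (odometer-forced p) ⟩
        u p                                ∎

    stable-value : ∀ w → c w ≡ digitAt (length w)
    stable-value w = +-cancelʳ-≡ (suc k * odometer w) _ _ (begin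
        c w + suc k * odometer w                 ≡⟨ cong (λ x → c w + suc k * x) (sym (odometer-forced w)) ⟩
        c w + suc k * u w                        ≡⟨ balance odo w ⟩
        initial N w + inflow u w                 ≡⟨ cong (initial N w +_) (inflow-cong odometer-forced w) ⟩
        initial N w + inflow odometer w          ≡⟨ initial-balance w ⟩
        digitAt (length w) + suc k * odometer w  ∎)
      where open ≡-Reasoning

  stable-configuration : ∀ {c} → initial N ⟶* c → Stable c → ∀ w → c w ≡ digitAt (length w)
  stable-configuration ρ c-stable =
    let u , odo , u≤odometer = least-action odometer-refl (λ _ → z≤n) ρ
    in Forced.stable-value odo c-stable u≤odometer
    where open LeastAction {initial N} {odometer} odometer-stabilizing

mainTheorem1 : (k n N : ℕ) → 2 ≤ k → 1 ≤ n →
    k ^ n ∸ 1 ≤ N * (k ∸ 1) → N * (k ∸ 1) ≤ k ^ suc n ∸ k →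
    (∃[ c ] (initial {k} N ⟶* c × Stable c)) ×
    (∀ (c : Config k) → initial {k} N ⟶* c → Stable c →
      (∀ v → (0 < c v) ⇔ (length v < n)) ×
      (∀ v w → length v ≡ length w → c v ≡ c w))
mainTheorem1 k@(suc (suc k₁)) n N (s≤s (s≤s z≤n)) _ lower upper = initial-stabilizes , stable-is-layered
  where
  N-digits : HasDigits k n N
  N-digits = HasDigits-from-powers (suc k₁) n N lower upper
  open BijectiveDigits k
  open Expansion n N N-digits
  open Stabilization k n N N-digits

  stable-is-layered : ∀ c → initial N ⟶* c → Stable c →
    (∀ v → (0 < c v) ⇔ (length v < n)) × (∀ v w → length v ≡ length w → c v ≡ c w)
  stable-is-layered c ρ c-stable =
      (λ v → subst (λ a → 0 < a ⇔ length v < n) (sym (c≡digit v)) (0<digitAt⇔ (length v)))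
    , (λ v w |v|≡|w| → trans (c≡digit v) (trans (cong digitAt |v|≡|w|) (sym (c≡digit w))))
    where c≡digit = stable-configuration ρ c-stable
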